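{- Let $p$ be a prime which is either $p=2$ or a $3 \bmod 4$ prime. If two $p$-clock sums are distinct, then they are not equal as elements of $\Omega_2$.
   Context: $\mathbb{N}=\{0,1,2,\dots\}$. For a prime $p$ and integer $0\le t\le p-1$, the prime clock $[p,t]:\mathbb{N}\to\mathbb{N}$ is $[p,t](m)=(m+t)\bmod p$. $\Omega_2$ is the set of functions $\mathbb{N}\to\{0,1\}$; the sum $[p,t_1]\oplus\cdots\oplus[p,t_l]\in\Omega_2$ is the function $m\mapsto\big(\sum_{i=1}^l[p,t_i](m)\big)\bmod 2$. A $p$-clock sum of length $l$ is such a sum with $t_1,\dots,t_l\in\{0,\dots,p-1\}$ pairwise distinct ($1\le l\le p$). Two $p$-clock sums $[p,s_1]\oplus\cdots\oplus[p,s_l]$ and $[p,t_1]\oplus\cdots\oplus[p,t_m]$ (written with $s_1<\cdots<s_l$ and $t_1<\cdots<t_m$) are distinct if $l\ne m$ or $s_i\ne t_i$ for some $i$, i.e. if the sets $\{s_1,\dots,s_l\}$ and $\{t_1,\dots,t_m\}$ differ. An odd prime $p$ is a $3\bmod 4$ prime if $(p-1)/2$ is odd. -}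

module Defs where

open import Data.Nat using (ℕ; _+_; _∸_; _/_; _%_; NonZero)
open import Data.Nat.Primality using (Prime)
open import Data.Bool using (Bool; true; false; if_then_else_)
open import Data.Fin using (Fin; toℕ; zero; suc)
open import Data.Fin.Subset using (Subset; Nonempty)
open import Data.Vec using (Vec; []; _∷_)
open import Data.Product using (_×_; Σ)
open import Data.Sum using (_⊎_)
open import Relation.Binary.PropositionalEquality using (_≡_)

Odd : ℕ → Set
Odd n = n % 2 ≡ 1

ThreeMod4Prime : ℕ → Set
ThreeMod4Prime p = Prime p × Odd p × Odd ((p ∸ 1) / 2)

clock : (p : ℕ) → .{{NonZero p}} → ℕ → ℕ → ℕ
clock p t m = (m + t) % p

-- Omega_2 = functions ℕ → {0,1}; we model them as ℕ → ℕ with values in {0,1}.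
Ω₂ : Set
Ω₂ = ℕ → ℕ

sumSubset : ∀ {n} → Subset n → (Fin n → ℕ) → ℕ
sumSubset [] f = 0
sumSubset (true ∷ S) f = f zero + sumSubset S (λ i → f (suc i))
sumSubset (false ∷ S) f = sumSubset S (λ i → f (suc i))

clockSum : (p : ℕ) → .{{NonZero p}} → Subset p → Ω₂
clockSum p S m = sumSubset S (λ t → clock p (toℕ t) m) % 2

_≐_ : Ω₂ → Ω₂ → Set
f ≐ g = ∀ m → f m ≡ g m

-- Reduce everything mod 2: the parity of the clock sum of S at m is the ℤ/2 inner product
-- ⟨ 1_S , c_m ⟩ with c_m(i) = parity ((m + i) mod p), so equal clock sums make u = 1_S + 1_T
-- orthogonal to every c_m. For odd p, stepping m flips every parity except at the single
-- index i with (m + i) mod p = p − 1, where the wrap from the even p − 1 to 0 keeps it; hence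
-- c_{m+1} = 1 + c_m + e_m with e_m that unit vector, and orthogonality forces every coordinate
-- of u to equal Σ u. The constant 1 is excluded because ⟨ 1 , c_0 ⟩ counts the (p − 1)/2 odd
-- numbers below p, an odd number for p ≡ 3 mod 4. So u = 0, i.e. S = T.

module Submission where

open import Data.Bool using (Bool; true; false)
open import Data.Fin using (Fin; zero; suc; toℕ)
open import Data.Fin.Properties using (toℕ<n)
open import Data.Fin.Subset using (Subset; Nonempty)
open import Data.Nat using (ℕ; zero; suc; _+_; _*_; _∸_; _/_; _%_; _≤_; _<_; _≟_; z≤n; s≤s; NonZero; parity)
open import Data.Nat.DivMod
open import Data.Nat.Properties
open import Data.Nat.Solver using (module +-*-Solver)
open import Data.Parity.Base using (Parity; 0ℙ; 1ℙ) renaming (_+_ to _⊕_; _*_ to _·_)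
import Data.Parity.Properties as ℙ
open import Algebra.Properties.Semiring.Sum ℙ.+-*-semiring
  using (sum; sum-cong-≗; sum-replicate-zero; ∑-distrib-+)
open import Data.Product using (_,_)
open import Data.Sum using (_⊎_; inj₁; inj₂)
open import Data.Vec using (_∷_; []; lookup; tabulate)
open import Data.Vec.Functional using (Vector)
open import Data.Vec.Properties using (tabulate∘lookup; tabulate-cong)
open import Function using (_∘_; _⇔_; mk⇔)
open import Relation.Binary.PropositionalEquality
open import Relation.Nullary using (¬_; does; contradiction)
open import Relation.Nullary.Decidable using (does-⇔; dec-true; dec-false)

open import Defs

toParity : Bool → Parity
toParity true = 1ℙ
toParity false = 0ℙ

toParity-injective : ∀ {a b} → toParity a ≡ toParity b → a ≡ b
toParity-injective {true} {true} _ = refl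
toParity-injective {false} {false} _ = refl

⊕≡0ℙ⇒≡ : ∀ {x y} → x ⊕ y ≡ 0ℙ → x ≡ y
⊕≡0ℙ⇒≡ {0ℙ} {0ℙ} _ = refl
⊕≡0ℙ⇒≡ {1ℙ} {1ℙ} _ = refl

parity-*2 : ∀ n → parity (n * 2) ≡ 0ℙ
parity-*2 n = trans (ℙ.*-homo-* n 2) (ℙ.*-zeroʳ (parity n))

parity-%2 : ∀ n → parity (n % 2) ≡ parity n
parity-%2 n = sym (begin
  parity n                             ≡⟨ cong parity (m≡m%n+[m/n]*n n 2) ⟩
  parity (n % 2 + n / 2 * 2)           ≡⟨ ℙ.+-homo-+ (n % 2) (n / 2 * 2) ⟩
  parity (n % 2) ⊕ parity (n / 2 * 2)  ≡⟨ cong (parity (n % 2) ⊕_) (parity-*2 (n / 2)) ⟩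
  parity (n % 2) ⊕ 0ℙ                  ≡⟨ ℙ.+-identityʳ (parity (n % 2)) ⟩
  parity (n % 2)                       ∎)
  where open ≡-Reasoning

odd⇒parity≡1ℙ : ∀ {n} → Odd n → parity n ≡ 1ℙ
odd⇒parity≡1ℙ {n} n-odd = trans (sym (parity-%2 n)) (cong parity n-odd)

odd[1+k]⇒k≡[1+k]/2*2 : ∀ k → Odd (suc k) → k ≡ suc k / 2 * 2
odd[1+k]⇒k≡[1+k]/2*2 k 1+k-odd =
  suc-injective (trans (m≡m%n+[m/n]*n (suc k) 2) (cong (_+ suc k / 2 * 2) 1+k-odd))

odd[1+k]⇒even[k] : ∀ k → Odd (suc k) → parity k ≡ 0ℙ
odd[1+k]⇒even[k] k 1+k-odd = trans (cong parity (odd[1+k]⇒k≡[1+k]/2*2 k 1+k-odd)) (parity-*2 (suc k / 2))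

odd[1+k]⇒[1+k]/2≡k/2 : ∀ k → Odd (suc k) → suc k / 2 ≡ k / 2
odd[1+k]⇒[1+k]/2≡k/2 k 1+k-odd =
  trans (sym (m*n/n≡m (suc k / 2) 2)) (cong (_/ 2) (sym (odd[1+k]⇒k≡[1+k]/2*2 k 1+k-odd)))

∑-parity : ∀ n → sum (λ (i : Fin n) → parity (toℕ i)) ≡ parity (n / 2)
∑-parity zero = refl
∑-parity (suc zero) = refl
∑-parity (suc (suc n)) = begin
  1ℙ ⊕ sum (λ (i : Fin n) → parity (toℕ i))  ≡⟨ cong (1ℙ ⊕_) (∑-parity n) ⟩
  1ℙ ⊕ parity (n / 2)                        ≡⟨ ℙ.+-homo-+ 1 (n / 2) ⟨
  parity (suc (n / 2))                       ≡⟨ cong parity (m/n≡1+[m∸n]/n (s≤s (s≤s (z≤n {n})))) ⟨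
  parity (suc (suc n) / 2)                   ∎
  where open ≡-Reasoning

⟨_,_⟩ : ∀ {n} → Vector Parity n → Vector Parity n → Parity
⟨ u , v ⟩ = sum (λ i → u i · v i)

⟨⟩-congʳ : ∀ {n} (u : Vector Parity n) {v w : Vector Parity n} → (∀ i → v i ≡ w i) → ⟨ u , v ⟩ ≡ ⟨ u , w ⟩
⟨⟩-congʳ u v≗w = sum-cong-≗ (λ i → cong (u i ·_) (v≗w i))

⟨⟩-distribˡ : ∀ {n} (u v w : Vector Parity n) → ⟨ (λ i → u i ⊕ v i) , w ⟩ ≡ ⟨ u , w ⟩ ⊕ ⟨ v , w ⟩
⟨⟩-distribˡ u v w = trans (sum-cong-≗ (λ i → ℙ.*-distribʳ-+ (w i) (u i) (v i))) (∑-distrib-+ (λ i → u i · w i) (λ i → v i · w i))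

⟨⟩-distribʳ : ∀ {n} (u v w : Vector Parity n) → ⟨ u , (λ i → v i ⊕ w i) ⟩ ≡ ⟨ u , v ⟩ ⊕ ⟨ u , w ⟩
⟨⟩-distribʳ u v w = trans (sum-cong-≗ (λ i → ℙ.*-distribˡ-+ (u i) (v i) (w i))) (∑-distrib-+ (λ i → u i · v i) (λ i → u i · w i))

⟨⟩-zeroʳ : ∀ {n} (u : Vector Parity n) → ⟨ u , (λ _ → 0ℙ) ⟩ ≡ 0ℙ
⟨⟩-zeroʳ {n} u = trans (sum-cong-≗ (λ i → ℙ.*-zeroʳ (u i))) (sum-replicate-zero n)

⟨⟩-oneʳ : ∀ {n} (u : Vector Parity n) → ⟨ u , (λ _ → 1ℙ) ⟩ ≡ sum u
⟨⟩-oneʳ u = sum-cong-≗ (λ i → ℙ.*-identityʳ (u i))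

δ : ∀ {n} → Fin n → Vector Parity n
δ j i = toParity (does (toℕ i ≟ toℕ j))

⟨⟩-δ : ∀ {n} (u : Vector Parity n) j → ⟨ u , δ j ⟩ ≡ u j
⟨⟩-δ u zero = trans (cong₂ _⊕_ (ℙ.*-identityʳ (u zero)) (⟨⟩-zeroʳ (u ∘ suc))) (ℙ.+-identityʳ (u zero))
⟨⟩-δ u (suc j) = cong₂ _⊕_ (ℙ.*-zeroʳ (u zero)) (⟨⟩-δ (u ∘ suc) j)

indicator : ∀ {n} → Subset n → Vector Parity n
indicator S i = toParity (lookup S i)

parity-sumSubset : ∀ {n} (S : Subset n) (f : Fin n → ℕ) → parity (sumSubset S f) ≡ ⟨ indicator S , parity ∘ f ⟩
parity-sumSubset [] f = refl
parity-sumSubset (true ∷ S) f =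
  trans (ℙ.+-homo-+ (f zero) _) (cong (parity (f zero) ⊕_) (parity-sumSubset S (f ∘ suc)))
parity-sumSubset (false ∷ S) f = parity-sumSubset S (f ∘ suc)

≡-fromIndicators : ∀ {n} (S T : Subset n) → (∀ j → indicator S j ⊕ indicator T j ≡ 0ℙ) → S ≡ T
≡-fromIndicators S T S∆T≡∅ = begin
  S                    ≡⟨ tabulate∘lookup S ⟨
  tabulate (lookup S)  ≡⟨ tabulate-cong (λ j → toParity-injective (⊕≡0ℙ⇒≡ (S∆T≡∅ j))) ⟩
  tabulate (lookup T)  ≡⟨ tabulate∘lookup T ⟩
  T                    ∎
  where open ≡-Reasoning

suc-%-distrib : ∀ n d .{{_ : NonZero d}} → suc n % d ≡ suc (n % d) % d
suc-%-distrib n d =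
  trans (cong (λ x → suc x % d) (m≡m%n+[m/n]*n n d)) ([m+kn]%n≡m%n (suc (n % d)) (n / d) d)

[k∸j+i]%[1+k]≡k⇔i≡j : ∀ {k i j} → i ≤ k → j ≤ k → ((k ∸ j + i) % suc k ≡ k ⇔ i ≡ j)
[k∸j+i]%[1+k]≡k⇔i≡j {k} {i} {j} i≤k j≤k = mk⇔ to from
  where
  open ≡-Reasoning
  k∸j+j≡k : k ∸ j + j ≡ k
  k∸j+j≡k = m∸n+n≡m j≤k

  from : i ≡ j → (k ∸ j + i) % suc k ≡ k
  from refl = trans (cong (_% suc k) k∸j+j≡k) (m≤n⇒m%n≡m ≤-refl)

  to : (k ∸ j + i) % suc k ≡ k → i ≡ j
  to hit with ≤-<-connex i j
  ... | inj₁ i≤j = +-cancelˡ-≡ (k ∸ j) i j (begin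
    k ∸ j + i            ≡⟨ m≤n⇒m%n≡m (≤-trans (+-monoʳ-≤ (k ∸ j) i≤j) (≤-reflexive k∸j+j≡k)) ⟨
    (k ∸ j + i) % suc k  ≡⟨ hit ⟩
    k                    ≡⟨ k∸j+j≡k ⟨
    k ∸ j + j            ∎)
  ... | inj₂ j<i = contradiction d≡k (<⇒≢ (≤-trans d<i i≤k))
    where
    d : ℕ
    d = i ∸ suc j
    d+1+j≡i : d + suc j ≡ i
    d+1+j≡i = m∸n+n≡m j<i
    d<i : d < i
    d<i = subst (d <_) d+1+j≡i (m<m+n d (s≤s z≤n))
    d≡k : d ≡ k
    d≡k = begin
      d                              ≡⟨ m≤n⇒m%n≡m (≤-trans (<⇒≤ d<i) i≤k) ⟨
      d % suc k                      ≡⟨ [m+n]%n≡m%n d (suc k) ⟨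
      (d + suc k) % suc k            ≡⟨ cong (λ x → (d + suc x) % suc k) k∸j+j≡k ⟨
      (d + suc (k ∸ j + j)) % suc k  ≡⟨ cong (_% suc k) (solve 3 (λ a d j → d :+ (con 1 :+ (a :+ j)) := a :+ (d :+ (con 1 :+ j))) refl (k ∸ j) d j) ⟩
      (k ∸ j + (d + suc j)) % suc k  ≡⟨ cong (λ x → (k ∸ j + x) % suc k) d+1+j≡i ⟩
      (k ∸ j + i) % suc k            ≡⟨ hit ⟩
      k                              ∎
      where open +-*-Solver

module _ (k : ℕ) where

  clockParity : ℕ → Vector Parity (suc k)
  clockParity m i = parity ((m + toℕ i) % suc k)

  hitsLast : ℕ → Vector Parity (suc k)
  hitsLast m i = toParity (does ((m + toℕ i) % suc k ≟ k))

  parity-suc-% : parity k ≡ 0ℙ → ∀ {a} → a ≤ k → parity (suc a % suc k) ≡ 1ℙ ⊕ parity a ⊕ toParity (does (a ≟ k))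
  parity-suc-% k-even {a} a≤k with m≤n⇒m<n∨m≡n a≤k
  ... | inj₂ refl = begin
    parity (suc k % suc k)  ≡⟨ cong parity (n%n≡0 (suc k)) ⟩
    0ℙ                      ≡⟨ cong (λ x → 1ℙ ⊕ x ⊕ 1ℙ) k-even ⟨
    1ℙ ⊕ parity k ⊕ 1ℙ      ≡⟨ cong (λ b → 1ℙ ⊕ parity k ⊕ toParity b) (dec-true (k ≟ k) refl) ⟨
    1ℙ ⊕ parity k ⊕ toParity (does (k ≟ k)) ∎
    where open ≡-Reasoning
  ... | inj₁ a<k = begin
    parity (suc a % suc k)  ≡⟨ cong parity (m≤n⇒m%n≡m a<k) ⟩
    parity (suc a)          ≡⟨ ℙ.+-homo-+ 1 a ⟩
    1ℙ ⊕ parity a           ≡⟨ ℙ.+-identityʳ (1ℙ ⊕ parity a) ⟨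
    1ℙ ⊕ parity a ⊕ 0ℙ      ≡⟨ cong (λ b → 1ℙ ⊕ parity a ⊕ toParity b) (dec-false (a ≟ k) (<⇒≢ a<k)) ⟨
    1ℙ ⊕ parity a ⊕ toParity (does (a ≟ k)) ∎
    where open ≡-Reasoning

  clockParity-suc : parity k ≡ 0ℙ → ∀ m i → clockParity (suc m) i ≡ 1ℙ ⊕ clockParity m i ⊕ hitsLast m i
  clockParity-suc k-even m i =
    trans (cong parity (suc-%-distrib (m + toℕ i) (suc k))) (parity-suc-% k-even (≤-pred (m%n<n (m + toℕ i) (suc k))))

  hitsLast-δ : ∀ j i → hitsLast (k ∸ toℕ j) i ≡ δ j i
  hitsLast-δ j i = cong toParity
    (does-⇔ ([k∸j+i]%[1+k]≡k⇔i≡j (≤-pred (toℕ<n i)) (≤-pred (toℕ<n j))) (_ ≟ k) (toℕ i ≟ toℕ j))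

  module _ (k-even : parity k ≡ 0ℙ) (u : Vector Parity (suc k)) (u⊥clocks : ∀ m → ⟨ u , clockParity m ⟩ ≡ 0ℙ) where

    sum⊕⟨hitsLast⟩≡0ℙ : ∀ m → sum u ⊕ ⟨ u , hitsLast m ⟩ ≡ 0ℙ
    sum⊕⟨hitsLast⟩≡0ℙ m = begin
      sum u ⊕ ⟨ u , hitsLast m ⟩                                          ≡⟨ cong (_⊕ ⟨ u , hitsLast m ⟩) (ℙ.+-identityʳ (sum u)) ⟨
      sum u ⊕ 0ℙ ⊕ ⟨ u , hitsLast m ⟩                                     ≡⟨ cong₂ (λ x y → x ⊕ y ⊕ ⟨ u , hitsLast m ⟩) (⟨⟩-oneʳ u) (u⊥clocks m) ⟨
      ⟨ u , (λ _ → 1ℙ) ⟩ ⊕ ⟨ u , clockParity m ⟩ ⊕ ⟨ u , hitsLast m ⟩    ≡⟨ cong (_⊕ ⟨ u , hitsLast m ⟩) (⟨⟩-distribʳ u (λ _ → 1ℙ) (clockParity m)) ⟨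
      ⟨ u , (λ i → 1ℙ ⊕ clockParity m i) ⟩ ⊕ ⟨ u , hitsLast m ⟩          ≡⟨ ⟨⟩-distribʳ u (λ i → 1ℙ ⊕ clockParity m i) (hitsLast m) ⟨
      ⟨ u , (λ i → 1ℙ ⊕ clockParity m i ⊕ hitsLast m i) ⟩                ≡⟨ ⟨⟩-congʳ u (clockParity-suc k-even m) ⟨
      ⟨ u , clockParity (suc m) ⟩                                         ≡⟨ u⊥clocks (suc m) ⟩
      0ℙ                                                                  ∎
      where open ≡-Reasoning

    orthogonal⇒constant : ∀ j → u j ≡ sum u
    orthogonal⇒constant j = begin
      u j                               ≡⟨ ⟨⟩-δ u j ⟨
      ⟨ u , δ j ⟩                       ≡⟨ ⟨⟩-congʳ u (hitsLast-δ j) ⟨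
      ⟨ u , hitsLast (k ∸ toℕ j) ⟩      ≡⟨ ⊕≡0ℙ⇒≡ (sum⊕⟨hitsLast⟩≡0ℙ (k ∸ toℕ j)) ⟨
      sum u                             ∎
      where open ≡-Reasoning

  orthogonal⇒zero : parity k ≡ 0ℙ → parity (suc k / 2) ≡ 1ℙ → (u : Vector Parity (suc k)) →
    (∀ m → ⟨ u , clockParity m ⟩ ≡ 0ℙ) → ∀ j → u j ≡ 0ℙ
  orthogonal⇒zero k-even half-odd u u⊥clocks j with sum u in Σu
  ... | 0ℙ = trans (orthogonal⇒constant k-even u u⊥clocks j) Σu
  ... | 1ℙ = contradiction (begin
    1ℙ                                          ≡⟨ half-odd ⟨
    parity (suc k / 2)                          ≡⟨ ∑-parity (suc k) ⟨
    sum (λ (i : Fin (suc k)) → parity (toℕ i))  ≡⟨ sum-cong-≗ (λ i → cong₂ _·_ (u≡1ℙ i) (cong parity (m<n⇒m%n≡m (toℕ<n i)))) ⟨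
    ⟨ u , clockParity 0 ⟩                       ≡⟨ u⊥clocks 0 ⟩
    0ℙ                                          ∎) λ ()
    where
    open ≡-Reasoning
    u≡1ℙ : ∀ i → u i ≡ 1ℙ
    u≡1ℙ i = trans (orthogonal⇒constant k-even u u⊥clocks i) Σu

parity-clockSum : ∀ k (S : Subset (suc k)) m → parity (clockSum (suc k) S m) ≡ ⟨ indicator S , clockParity k m ⟩
parity-clockSum k S m = trans (parity-%2 (sumSubset S clockValue)) (parity-sumSubset S clockValue)
  where
  clockValue : Fin (suc k) → ℕ
  clockValue t = clock (suc k) (toℕ t) m

clockSums-orthogonal : ∀ k (S T : Subset (suc k)) → clockSum (suc k) S ≐ clockSum (suc k) T →
  ∀ m → ⟨ (λ i → indicator S i ⊕ indicator T i) , clockParity k m ⟩ ≡ 0ℙ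
clockSums-orthogonal k S T S≐T m = begin
  ⟨ (λ i → indicator S i ⊕ indicator T i) , clockParity k m ⟩  ≡⟨ ⟨⟩-distribˡ (indicator S) (indicator T) (clockParity k m) ⟩
  ⟨ indicator S , clockParity k m ⟩ ⊕ ⟨ indicator T , clockParity k m ⟩  ≡⟨ cong (_⊕ ⟨ indicator T , clockParity k m ⟩) ⟨S⟩≡⟨T⟩ ⟩
  ⟨ indicator T , clockParity k m ⟩ ⊕ ⟨ indicator T , clockParity k m ⟩  ≡⟨ ℙ.p+p≡0ℙ ⟨ indicator T , clockParity k m ⟩ ⟩
  0ℙ  ∎
  where
  open ≡-Reasoning
  ⟨S⟩≡⟨T⟩ : ⟨ indicator S , clockParity k m ⟩ ≡ ⟨ indicator T , clockParity k m ⟩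
  ⟨S⟩≡⟨T⟩ = trans (sym (parity-clockSum k S m)) (trans (cong parity (S≐T m)) (parity-clockSum k T m))

-- The wrap-around argument needs p odd; for p = 2 the parity vectors at m = 1 and m = 0 are the unit vectors.
orthogonal₂⇒zero : (u : Vector Parity 2) → (∀ m → ⟨ u , clockParity 1 m ⟩ ≡ 0ℙ) → ∀ j → u j ≡ 0ℙ
orthogonal₂⇒zero u u⊥clocks zero = trans (sym ⟨u,[2,1]⟩≡u₀) (u⊥clocks 1)
  where
  ⟨u,[2,1]⟩≡u₀ : ⟨ u , clockParity 1 1 ⟩ ≡ u zero
  ⟨u,[2,1]⟩≡u₀ = trans (cong₂ _⊕_ (ℙ.*-identityʳ (u zero)) (cong (_⊕ 0ℙ) (ℙ.*-zeroʳ (u (suc zero))))) (ℙ.+-identityʳ (u zero))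
orthogonal₂⇒zero u u⊥clocks (suc zero) = trans (sym ⟨u,[2,0]⟩≡u₁) (u⊥clocks 0)
  where
  ⟨u,[2,0]⟩≡u₁ : ⟨ u , clockParity 1 0 ⟩ ≡ u (suc zero)
  ⟨u,[2,0]⟩≡u₁ = cong₂ _⊕_ (ℙ.*-zeroʳ (u zero)) (trans (ℙ.+-identityʳ (u (suc zero) · 1ℙ)) (ℙ.*-identityʳ (u (suc zero))))

mainTheorem4 : (p : ℕ) → .{{_ : NonZero p}} → (p ≡ 2 ⊎ ThreeMod4Prime p) →
    (S T : Subset p) → Nonempty S → Nonempty T → ¬ (S ≡ T) →
    ¬ (clockSum p S ≐ clockSum p T)
mainTheorem4 .2 (inj₁ refl) S T _ _ S≢T S≐T =
  S≢T (≡-fromIndicators S T (orthogonal₂⇒zero _ (clockSums-orthogonal 1 S T S≐T)))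
mainTheorem4 zero (inj₂ (_ , () , _))
mainTheorem4 (suc k) (inj₂ (_ , p-odd , half-odd)) S T _ _ S≢T S≐T =
  S≢T (≡-fromIndicators S T (orthogonal⇒zero k k-even p/2-odd _ (clockSums-orthogonal k S T S≐T)))
  where
  k-even : parity k ≡ 0ℙ
  k-even = odd[1+k]⇒even[k] k p-odd
  p/2-odd : parity (suc k / 2) ≡ 1ℙ
  p/2-odd = trans (cong parity (odd[1+k]⇒[1+k]/2≡k/2 k p-odd)) (odd⇒parity≡1ℙ {k / 2} half-odd)
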